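{- There is a family $\{G^{(n)}\}$ of deterministic presentations such that, for all sufficiently large $n$, $G^{(n)}$ has $n$ vertices and the minimum length of a synchronizing word for $G^{(n)}$ is $2^{\Omega(n)}$.
   Context: A labeled graph has finite vertex and edge sets, edges with initial/terminal vertices and labels from a finite alphabet; a presentation is an essential labeled graph (every vertex has an incoming and an outgoing edge), and it is deterministic if no vertex has two outgoing edges with the same label. For deterministic $G$ with vertex set $Q_G$, $Q_G\cdot w$ is the set of end vertices of paths labeled $w$ (starting anywhere); $w$ is synchronizing for $G$ if $|Q_G\cdot w|=1$. -}

module Defs where

open import Data.Nat using (ℕ)
open import Data.Fin using (Fin)
open import Data.List using (List; []; _∷_)
open import Data.Product using (Σ; ∃; ∃-syntax; _×_)
open import Relation.Binary.PropositionalEquality using (_≡_)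

record LabeledGraph : Set where
  field
    nV nE nA : ℕ
    init  : Fin nE → Fin nV
    term  : Fin nE → Fin nV
    label : Fin nE → Fin nA

open LabeledGraph public

Word : LabeledGraph → Set
Word G = List (Fin (nA G))

IsPresentation : LabeledGraph → Set
IsPresentation G =
  (v : Fin (nV G)) → (∃[ e ] term G e ≡ v) × (∃[ e ] init G e ≡ v)

Deterministic : LabeledGraph → Set
Deterministic G =
  (e e′ : Fin (nE G)) → init G e ≡ init G e′ → label G e ≡ label G e′ → e ≡ e′

data Path (G : LabeledGraph) : Fin (nV G) → Word G → Fin (nV G) → Set where
  nil  : (p : Fin (nV G)) → Path G p [] p
  step : {p q : Fin (nV G)} {w : Word G} (e : Fin (nE G)) →
         init G e ≡ p → Path G (term G e) w q → Path G p (label G e ∷ w) q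

_∈Q·_ : {G : LabeledGraph} → Fin (nV G) → Word G → Set
_∈Q·_ {G} q w = ∃[ p ] Path G p w q

Synchronizing : (G : LabeledGraph) → Word G → Set
Synchronizing G w =
  ∃[ q ] (_∈Q·_ {G} q w × ((q′ : Fin (nV G)) → _∈Q·_ {G} q′ w → q′ ≡ q))

{-# OPTIONS --safe #-}
module Submission where

-- G⁽ⁿ⁾ simulates an m-bit binary counter, m ≈ n/4, with one block of four vertices per bit,
-- a sink and at most three padding vertices.  The letter inc j is a legal increment at position j (bits below j read 1, bit j
-- reads 0) and sends a bit into a trap otherwise; reset sets every bit to 0; finish sends a
-- bit reading 1 to the sink and every other vertex to an idle vertex, which dies on reset.
-- Two bits can only be merged in the sink, so a synchronizing word must, between its last
-- reset and its first finish, bring every bit from 0 to 1 by legal increments.  Each legal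
-- increment raises the value of the counter by exactly one, so this segment has length
-- 2^m - 1, and 2^n ≤ 2^(8m) ≤ |w|^8.

open import Defs
open import Data.Nat using (ℕ; _≤_; _^_)
open import Data.List using (length)
open import Data.Product using (Σ; ∃; ∃-syntax; _×_)
open import Relation.Binary.PropositionalEquality using (_≡_)

open import Data.Nat using (zero; suc; _+_; _*_; pred; _/_; _%_; z≤n; s≤s)
open import Data.Nat.Properties
  using (+-suc; +-identityʳ; *-suc; *-distribˡ-+; *-monoˡ-≤; +-monoˡ-≤; ≤-trans; ^-*-assoc; ^-monoˡ-≤; ^-monoʳ-≤; module ≤-Reasoning)
open import Data.Nat.DivMod using (m≡m%n+[m/n]*n; m%n<n; /-monoˡ-≤)
open import Data.Fin using (Fin; zero; suc; toℕ; fromℕ<)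
open import Data.Fin.Patterns using (0F; 1F; 2F; 3F)
open import Data.Fin.Properties using (+↔⊎; *↔×; 1↔⊤; toℕ-fromℕ<) renaming (_≟_ to _≟ᶠ_)
open import Data.List using (List; []; _∷_; _++_; map; lookup; filter; cartesianProduct; allFin)
open import Data.List.Properties using (length-map; length-++-≤ʳ; length-++-≤ˡ)
open import Data.List.Membership.Propositional using (_∈_)
open import Data.List.Membership.Propositional.Properties using (∈-filter⁺; ∈-filter⁻; ∈-cartesianProduct⁺; ∈-allFin; ∈-lookup)
open import Data.List.Relation.Unary.All using (All; []; _∷_)
import Data.List.Relation.Unary.All as All
open import Data.List.Relation.Unary.All.Properties using (++⁺; ++⁻ˡ; ++⁻ʳ)
open import Data.List.Relation.Unary.Any using (index)
open import Data.List.Relation.Unary.Any.Properties using (lookup-index)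
open import Data.List.Relation.Unary.Unique.Propositional using (Unique)
open import Data.List.Relation.Unary.AllPairs using (_∷_)
import Data.List.Relation.Unary.Unique.Propositional.Properties as Unique
open import Data.Maybe using (Maybe; just; nothing; is-just; fromMaybe; _>>=_)
open import Data.Maybe.Properties using (just-injective)
open import Data.Bool using (T)
open import Data.Unit using (⊤; tt)
open import Data.Empty using (⊥-elim)
open import Data.Sum using (_⊎_; inj₁; inj₂)
open import Data.Sum.Function.Propositional using (_⊎-↔_)
open import Data.Product using (_,_; proj₁; proj₂; ∃₂)
open import Function using (_∘_; id; _↔_; Inverse; mk↔ₛ′)
open import Function.Properties.Inverse using (↔-refl; ↔-sym; ↔-trans)
open import Relation.Nullary using (¬_; yes; no)
open import Relation.Nullary.Decidable using (T?)
open import Relation.Binary using (DecidableEquality)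
open import Relation.Unary using (Decidable)
open import Relation.Binary.PropositionalEquality using (_≢_; refl; sym; trans; cong; cong₂; subst; module ≡-Reasoning)

module _ {A : Set} (x : A) where

  data FirstSplit : List A → Set where
    absent : ∀ {w} → All (_≢ x) w → FirstSplit w
    first  : ∀ u v → All (_≢ x) u → FirstSplit (u ++ x ∷ v)

  data LastSplit : List A → Set where
    absent : ∀ {w} → All (_≢ x) w → LastSplit w
    last   : ∀ u v → All (_≢ x) v → LastSplit (u ++ x ∷ v)

module _ {A : Set} (_≟_ : DecidableEquality A) (x : A) where

  firstSplit : ∀ w → FirstSplit x w
  firstSplit [] = absent []
  firstSplit (a ∷ w) with a ≟ x
  ... | yes refl = first [] w []
  ... | no a≢x with firstSplit w
  ...   | absent ∉w     = absent (a≢x ∷ ∉w)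
  ...   | first u v ∉u = first (a ∷ u) v (a≢x ∷ ∉u)

  lastSplit : ∀ w → LastSplit x w
  lastSplit [] = absent []
  lastSplit (a ∷ w) with lastSplit w
  ... | last u v ∉v = last (a ∷ u) v ∉v
  ... | absent ∉w with a ≟ x
  ...   | yes refl = last [] w ∉w
  ...   | no a≢x   = absent (a≢x ∷ ∉w)

lookup-injective : {A : Set} {xs : List A} → Unique xs →
                   ∀ i j → lookup xs i ≡ lookup xs j → i ≡ j
lookup-injective (_ ∷ _) zero zero _ = refl
lookup-injective (x∉ ∷ _) zero (suc j) eq = ⊥-elim (All.lookup x∉ (∈-lookup j) eq)
lookup-injective (x∉ ∷ _) (suc i) zero eq = ⊥-elim (All.lookup x∉ (∈-lookup i) (sym eq))
lookup-injective (_ ∷ u) (suc i) (suc j) eq = cong suc (lookup-injective u i j eq)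

just-fromMaybe : {A : Set} (d : A) (mx : Maybe A) → T (is-just mx) → mx ≡ just (fromMaybe d mx)
just-fromMaybe d (just x) _ = refl

exponential-lower-bound : ∀ {n m k x} → n ≤ m * k → 2 ^ m ≤ x → 2 ^ n ≤ x ^ k
exponential-lower-bound {n} {m} {k} {x} n≤mk 2^m≤x = begin
  2 ^ n        ≤⟨ ^-monoʳ-≤ 2 n≤mk ⟩
  2 ^ (m * k)  ≡⟨ sym (^-*-assoc 2 m k) ⟩
  (2 ^ m) ^ k  ≤⟨ ^-monoˡ-≤ k 2^m≤x ⟩
  x ^ k        ∎
  where open ≤-Reasoning

distinct-elements : ∀ {m} → 2 ≤ m → ∃₂ λ (i j : Fin m) → i ≢ j
distinct-elements 2≤m = fromℕ< (≤-trans (s≤s z≤n) 2≤m) , fromℕ< 2≤m , λ eq →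
  0≢1 (trans (sym (toℕ-fromℕ< _)) (trans (cong toℕ eq) (toℕ-fromℕ< 2≤m)))
  where
  0≢1 : 0 ≢ 1
  0≢1 ()

module PartialAutomaton {V : Set} {n A : ℕ} (enumeration : V ↔ Fin n) (δ : V → Fin A → Maybe V) where

  open Inverse enumeration using (to; from; strictlyInverseˡ; strictlyInverseʳ)

  run : V → List (Fin A) → Maybe V
  run v [] = just v
  run v (a ∷ w) = δ v a >>= λ v′ → run v′ w

  run-∷ : ∀ {v a v′} w → δ v a ≡ just v′ → run v (a ∷ w) ≡ run v′ w
  run-∷ w eq = cong (_>>= λ v′ → run v′ w) eq

  run-++ : ∀ v u w → run v (u ++ w) ≡ (run v u >>= λ y → run y w)
  run-++ v [] w = refl
  run-++ v (a ∷ u) w with δ v a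
  ... | nothing = refl
  ... | just v′ = run-++ v′ u w

  run-++-just : ∀ {v y} u w → run v u ≡ just y → run v (u ++ w) ≡ run y w
  run-++-just {v} u w eq = trans (run-++ v u w) (cong (_>>= λ y → run y w) eq)

  Defined : Fin n × Fin A → Set
  Defined (p , a) = T (is-just (δ (from p) a))

  defined? : Decidable Defined
  defined? (p , a) = T? (is-just (δ (from p) a))

  transitions : List (Fin n × Fin A)
  transitions = filter defined? (cartesianProduct (allFin n) (allFin A))

  -- The default of fromMaybe is junk: only defined transitions are edges.
  target : Fin n × Fin A → Fin n
  target (p , a) = to (fromMaybe (from p) (δ (from p) a))

  graph : LabeledGraph
  graph = record
    { nV = n ; nE = length transitions ; nA = A
    ; init  = λ e → proj₁ (lookup transitions e)
    ; term  = λ e → target (lookup transitions e)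
    ; label = λ e → proj₂ (lookup transitions e)
    }

  edge-δ : ∀ e → δ (from (init graph e)) (label graph e) ≡ just (from (term graph e))
  edge-δ e with lookup transitions e | ∈-filter⁻ defined? {xs = cartesianProduct (allFin n) (allFin A)} (∈-lookup e)
  ... | (p , a) | (_ , defined) =
    trans (just-fromMaybe (from p) _ defined) (cong just (sym (strictlyInverseʳ _)))

  edge-of : ∀ {v a v′} → δ v a ≡ just v′ →
            ∃[ e ] init graph e ≡ to v × label graph e ≡ a × term graph e ≡ to v′
  edge-of {v} {a} {v′} eq = index ∈transitions , cong proj₁ e≡ , cong proj₂ e≡ ,
                            trans (cong target e≡) (cong (to ∘ fromMaybe _) δ-to)
    where
    δ-to : δ (from (to v)) a ≡ just v′
    δ-to = trans (cong (λ u → δ u a) (strictlyInverseʳ v)) eq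
    ∈transitions : (to v , a) ∈ transitions
    ∈transitions = ∈-filter⁺ defined? (∈-cartesianProduct⁺ (∈-allFin _) (∈-allFin a))
                             (subst (T ∘ is-just) (sym δ-to) tt)
    e≡ : lookup transitions (index ∈transitions) ≡ (to v , a)
    e≡ = sym (lookup-index ∈transitions)

  deterministic : Deterministic graph
  deterministic e e′ same-init same-label =
    lookup-injective transitions-unique e e′ (cong₂ _,_ same-init same-label)
    where
    transitions-unique : Unique transitions
    transitions-unique = Unique.filter⁺ defined?
      (Unique.cartesianProduct⁺ (Unique.allFin⁺ n) (Unique.allFin⁺ A))

  essential : (∀ v → ∃₂ λ u a → δ u a ≡ just v) → (∀ v → ∃₂ λ a v′ → δ v a ≡ just v′) →
              IsPresentation graph
  essential incoming outgoing p with incoming (from p) | outgoing (from p)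
  ... | (_ , _ , into) | (_ , _ , out) with edge-of into | edge-of out
  ...   | (e , _ , _ , e→) | (e′ , e′← , _) =
    (e , trans e→ (strictlyInverseˡ p)) , (e′ , trans e′← (strictlyInverseˡ p))

  path⇒run : ∀ {p w q} → Path graph p w q → run (from p) w ≡ just (from q)
  path⇒run (nil p) = refl
  path⇒run (step {w = w} e refl path) = trans (run-∷ w (edge-δ e)) (path⇒run path)

  run⇒path : ∀ v w {y} → run v w ≡ just y → Path graph (to v) w (to y)
  run⇒path v [] refl = nil (to v)
  run⇒path v (a ∷ w) {y} r with δ v a in eq
  ... | just v′ with edge-of eq
  ...   | e , e← , refl , e→ =
    step e e← (subst (λ q → Path graph q w (to y)) (sym e→) (run⇒path v′ w r))

  Collapsing : List (Fin A) → Set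
  Collapsing w = ∀ {v v′ y y′} → run v w ≡ just y → run v′ w ≡ just y′ → y ≡ y′

  synchronizing⇒defined : ∀ {w} → Synchronizing graph w → ∃₂ λ v y → run v w ≡ just y
  synchronizing⇒defined (q , (p , path) , _) = from p , from q , path⇒run path

  synchronizing⇒collapsing : ∀ {w} → Synchronizing graph w → Collapsing w
  synchronizing⇒collapsing {w} (q , _ , unique) {v} {v′} {y} {y′} r r′ = begin
    y              ≡⟨ sym (strictlyInverseʳ y) ⟩
    from (to y)    ≡⟨ cong from (trans (unique (to y) (to v , run⇒path v w r))
                                       (sym (unique (to y′) (to v′ , run⇒path v′ w r′)))) ⟩
    from (to y′)   ≡⟨ strictlyInverseʳ y′ ⟩
    y′             ∎
    where open ≡-Reasoning

  synchronizing : ∀ {w v z} → run v w ≡ just z → (∀ {v y} → run v w ≡ just y → y ≡ z) →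
                  Synchronizing graph w
  synchronizing {w} {v} {z} r ends-at-z = to z , (to v , run⇒path v w r) , unique
    where
    unique : ∀ q′ → _∈Q·_ {graph} q′ w → q′ ≡ to z
    unique q′ (p , path) = trans (sym (strictlyInverseˡ q′)) (cong to (ends-at-z (path⇒run path)))

data Cell : Set where
  off on trap : Cell

raise lower : Cell → Cell
raise off = on
raise _   = trap
lower on = off
lower _  = trap

-- bump j i: the effect on bit i of incrementing at position j (bit 0 is least significant).
bump : ∀ {m} → Fin m → Fin m → Cell → Cell
bump zero    zero    = raise
bump (suc j) zero    = lower
bump zero    (suc i) = id
bump (suc j) (suc i) = bump j i

bump-self : ∀ {m} (i : Fin m) → bump i i off ≡ on
bump-self zero    = refl
bump-self (suc i) = bump-self i

bumps : ∀ {m} → List (Fin m) → Fin m → Cell → Cell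
bumps []       i c = c
bumps (j ∷ js) i c = bumps js i (bump j i c)

bump-trap : ∀ {m} (j i : Fin m) → bump j i trap ≡ trap
bump-trap zero    zero    = refl
bump-trap (suc j) zero    = refl
bump-trap zero    (suc i) = refl
bump-trap (suc j) (suc i) = bump-trap j i

bumps-trap : ∀ {m} (js : List (Fin m)) i → bumps js i trap ≡ trap
bumps-trap []       i = refl
bumps-trap (j ∷ js) i rewrite bump-trap j i = bumps-trap js i

digit : Cell → ℕ
digit on = 1
digit _  = 0

value : ∀ {m} → (Fin m → Cell) → ℕ
value {zero}  s = 0
value {suc m} s = digit (s zero) + 2 * value (s ∘ suc)

value-off : ∀ {m} → value {m} (λ _ → off) ≡ 0
value-off {zero}  = refl
value-off {suc m} = cong (2 *_) (value-off {m})

value-on : ∀ {m} (s : Fin m → Cell) → (∀ i → s i ≡ on) → suc (value s) ≡ 2 ^ m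
value-on {zero}  s all-on = refl
value-on {suc m} s all-on = begin
  suc (digit (s zero) + 2 * value (s ∘ suc)) ≡⟨ cong (λ c → suc (digit c + 2 * value (s ∘ suc))) (all-on zero) ⟩
  suc (suc (2 * value (s ∘ suc)))            ≡⟨ sym (*-suc 2 _) ⟩
  2 * suc (value (s ∘ suc))                   ≡⟨ cong (2 *_) (value-on (s ∘ suc) (all-on ∘ suc)) ⟩
  2 * 2 ^ m                                   ∎
  where open ≡-Reasoning

value-bump : ∀ {m} (j : Fin m) (s : Fin m → Cell) → (∀ i → bump j i (s i) ≢ trap) →
             value (λ i → bump j i (s i)) ≡ suc (value s)
value-bump zero s legal with s zero | legal zero
... | off  | _      = refl
... | on   | legal₀ = ⊥-elim (legal₀ refl)
... | trap | legal₀ = ⊥-elim (legal₀ refl)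
value-bump (suc j) s legal with s zero | legal zero
... | off  | legal₀ = ⊥-elim (legal₀ refl)
... | trap | legal₀ = ⊥-elim (legal₀ refl)
... | on   | _      = begin
  2 * value (λ i → bump j i (s (suc i))) ≡⟨ cong (2 *_) (value-bump j (s ∘ suc) (legal ∘ suc)) ⟩
  2 * suc (value (s ∘ suc))              ≡⟨ *-suc 2 _ ⟩
  2 + 2 * value (s ∘ suc)                ∎
  where open ≡-Reasoning

-- Since trap is absorbing, a final state without trap was reached by legal increments only.
value-bumps : ∀ {m} (js : List (Fin m)) (s : Fin m → Cell) → (∀ i → bumps js i (s i) ≢ trap) →
              value (λ i → bumps js i (s i)) ≡ length js + value s
value-bumps []       s legal = refl
value-bumps (j ∷ js) s legal = begin
  value (λ i → bumps js i (bump j i (s i))) ≡⟨ value-bumps js (λ i → bump j i (s i)) legal ⟩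
  length js + value (λ i → bump j i (s i))  ≡⟨ cong (length js +_) (value-bump j s legal₁) ⟩
  length js + suc (value s)                 ≡⟨ +-suc (length js) (value s) ⟩
  suc (length js + value s)                 ∎
  where
  open ≡-Reasoning
  legal₁ : ∀ i → bump j i (s i) ≢ trap
  legal₁ i eq = legal i (trans (cong (bumps js i) eq) (bumps-trap js i))

counting-length : ∀ {m} (js : List (Fin m)) → (∀ i → bumps js i off ≡ on) → suc (length js) ≡ 2 ^ m
counting-length {m} js all-on = begin
  suc (length js)                           ≡⟨ cong suc (sym (+-identityʳ (length js))) ⟩
  suc (length js + 0)                       ≡⟨ cong (λ v → suc (length js + v)) (sym (value-off {m})) ⟩
  suc (length js + value {m} (λ _ → off))   ≡⟨ cong suc (sym (value-bumps js (λ _ → off) legal)) ⟩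
  suc (value (λ i → bumps js i off))        ≡⟨ value-on _ all-on ⟩
  2 ^ m                                     ∎
  where
  open ≡-Reasoning
  legal : ∀ i → bumps js i off ≢ trap
  legal i eq with trans (sym (all-on i)) eq
  ... | ()

-- Each increment of the upper bits carries through bit 0, which is then set again.
carried : ∀ {m} → List (Fin m) → List (Fin (suc m))
carried []       = []
carried (j ∷ js) = suc j ∷ zero ∷ carried js

countingWord : ∀ m → List (Fin m)
countingWord zero    = []
countingWord (suc m) = zero ∷ carried (countingWord m)

bumps-carried-zero : ∀ {m} (js : List (Fin m)) → bumps (carried js) zero on ≡ on
bumps-carried-zero []       = refl
bumps-carried-zero (j ∷ js) = bumps-carried-zero js

bumps-carried-suc : ∀ {m} (js : List (Fin m)) i c → bumps (carried js) (suc i) c ≡ bumps js i c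
bumps-carried-suc []       i c = refl
bumps-carried-suc (j ∷ js) i c = bumps-carried-suc js i (bump j i c)

bumps-countingWord : ∀ {m} (i : Fin m) → bumps (countingWord m) i off ≡ on
bumps-countingWord {suc m} zero    = bumps-carried-zero (countingWord m)
bumps-countingWord {suc m} (suc i) =
  trans (bumps-carried-suc (countingWord m) i off) (bumps-countingWord i)

module CounterAutomaton (m e : ℕ) where

  data Vertex : Set where
    sink   : Vertex
    pad    : Fin e → Vertex
    cell   : Fin m → Cell → Vertex
    frozen : Fin m → Vertex

  vertexIndex : Vertex ↔ Fin (suc (e + m * 4))
  vertexIndex = ↔-trans layout
    (↔-sym (↔-trans (+↔⊎ {1}) (1↔⊤ ⊎-↔ ↔-trans (+↔⊎ {e}) (↔-refl ⊎-↔ *↔× {m} {4}))))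
    where
    toSum : Vertex → ⊤ ⊎ (Fin e ⊎ Fin m × Fin 4)
    toSum sink          = inj₁ tt
    toSum (pad k)       = inj₂ (inj₁ k)
    toSum (cell i off)  = inj₂ (inj₂ (i , 0F))
    toSum (cell i on)   = inj₂ (inj₂ (i , 1F))
    toSum (cell i trap) = inj₂ (inj₂ (i , 2F))
    toSum (frozen i)    = inj₂ (inj₂ (i , 3F))
    fromSum : ⊤ ⊎ (Fin e ⊎ Fin m × Fin 4) → Vertex
    fromSum (inj₁ tt)              = sink
    fromSum (inj₂ (inj₁ k))        = pad k
    fromSum (inj₂ (inj₂ (i , 0F))) = cell i off
    fromSum (inj₂ (inj₂ (i , 1F))) = cell i on
    fromSum (inj₂ (inj₂ (i , 2F))) = cell i trap
    fromSum (inj₂ (inj₂ (i , 3F))) = frozen i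
    toSum∘fromSum : ∀ x → toSum (fromSum x) ≡ x
    toSum∘fromSum (inj₁ tt)              = refl
    toSum∘fromSum (inj₂ (inj₁ k))        = refl
    toSum∘fromSum (inj₂ (inj₂ (i , 0F))) = refl
    toSum∘fromSum (inj₂ (inj₂ (i , 1F))) = refl
    toSum∘fromSum (inj₂ (inj₂ (i , 2F))) = refl
    toSum∘fromSum (inj₂ (inj₂ (i , 3F))) = refl
    fromSum∘toSum : ∀ v → fromSum (toSum v) ≡ v
    fromSum∘toSum sink          = refl
    fromSum∘toSum (pad k)       = refl
    fromSum∘toSum (cell i off)  = refl
    fromSum∘toSum (cell i on)   = refl
    fromSum∘toSum (cell i trap) = refl
    fromSum∘toSum (frozen i)    = refl
    layout : Vertex ↔ (⊤ ⊎ (Fin e ⊎ Fin m × Fin 4))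
    layout = mk↔ₛ′ toSum fromSum toSum∘fromSum fromSum∘toSum

  Letter : Set
  Letter = Fin (2 + m)

  pattern reset  = zero
  pattern finish = suc zero
  pattern inc j  = suc (suc j)

  incs : List (Fin m) → List Letter
  incs = map λ j → inc j

  finished : Fin m → Cell → Vertex
  finished i on = sink
  finished i _  = frozen i

  δ : Vertex → Letter → Maybe Vertex
  δ (cell i c) reset   = just (cell i off)
  δ (cell i c) finish  = just (finished i c)
  δ (cell i c) (inc j) = just (cell i (bump j i c))
  δ _          reset   = nothing
  δ v          _       = just v

  open PartialAutomaton vertexIndex δ public

  data Idle : Vertex → Set where
    idle-sink   : Idle sink
    idle-pad    : ∀ k → Idle (pad k)
    idle-frozen : ∀ i → Idle (frozen i)

  finished-idle : ∀ i c → Idle (finished i c)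
  finished-idle i off  = idle-frozen i
  finished-idle i on   = idle-sink
  finished-idle i trap = idle-frozen i

  idle-reset : ∀ {v} → Idle v → δ v reset ≡ nothing
  idle-reset idle-sink       = refl
  idle-reset (idle-pad k)    = refl
  idle-reset (idle-frozen i) = refl

  idle-step : ∀ {v} → Idle v → ∀ a → a ≢ reset → δ v a ≡ just v
  idle-step idle            reset   a≢reset = ⊥-elim (a≢reset refl)
  idle-step idle-sink       (suc a) _       = refl
  idle-step (idle-pad k)    (suc a) _       = refl
  idle-step (idle-frozen i) (suc a) _       = refl

  idle-run : ∀ {v} {w : List Letter} → Idle v → All (_≢ reset) w → run v w ≡ just v
  idle-run idle [] = refl
  idle-run {w = _ ∷ w} idle (a≢reset ∷ ∉w) =
    trans (run-∷ w (idle-step idle _ a≢reset)) (idle-run idle ∉w)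

  idle-dies : ∀ {v} → Idle v → ∀ u w → run v (u ++ reset ∷ w) ≡ nothing
  idle-dies idle []          w = cong (_>>= λ v′ → run v′ w) (idle-reset idle)
  idle-dies idle (reset ∷ u) w = cong (_>>= λ v′ → run v′ (u ++ reset ∷ w)) (idle-reset idle)
  idle-dies idle (suc a ∷ u) w =
    trans (run-∷ (u ++ reset ∷ w) (idle-step idle (suc a) λ ())) (idle-dies idle u w)

  finish-step : ∀ v → ∃[ y ] δ v finish ≡ just y × Idle y
  finish-step (cell i c) = finished i c , refl , finished-idle i c
  finish-step sink       = sink , refl , idle-sink
  finish-step (pad k)    = pad k , refl , idle-pad k
  finish-step (frozen i) = frozen i , refl , idle-frozen i

  cell-run : ∀ {w : List Letter} i c → All (_≢ finish) w → ∃[ c′ ] run (cell i c) w ≡ just (cell i c′)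
  cell-run               i c []             = c , refl
  cell-run {reset ∷ _}  i c (_ ∷ ∉w)       = cell-run i off ∉w
  cell-run {finish ∷ _} i c (a≢finish ∷ _) = ⊥-elim (a≢finish refl)
  cell-run {inc j ∷ _}  i c (_ ∷ ∉w)       = cell-run i (bump j i c) ∉w

  cell-run-incs : ∀ i c js → run (cell i c) (incs js) ≡ just (cell i (bumps js i c))
  cell-run-incs i c []       = refl
  cell-run-incs i c (j ∷ js) = cell-run-incs i (bump j i c) js

  incs-only : ∀ {w : List Letter} → All (_≢ reset) w → All (_≢ finish) w → ∃[ js ] w ≡ incs js
  incs-only {[]}         [] [] = [] , refl
  incs-only {reset ∷ _}  (a≢reset ∷ _) _ = ⊥-elim (a≢reset refl)
  incs-only {finish ∷ _} _ (a≢finish ∷ _) = ⊥-elim (a≢finish refl)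
  incs-only {inc j ∷ _}  (_ ∷ ∉resets) (_ ∷ ∉finishes) with incs-only ∉resets ∉finishes
  ... | js , refl = j ∷ js , refl

  isPresentation : IsPresentation graph
  isPresentation = essential incoming outgoing
    where
    incoming : ∀ v → ∃₂ λ u a → δ u a ≡ just v
    incoming sink          = sink , finish , refl
    incoming (pad k)       = pad k , finish , refl
    incoming (cell i off)  = cell i off , reset , refl
    incoming (cell i on)   = cell i off , inc i , cong (λ c → just (cell i c)) (bump-self i)
    incoming (cell i trap) = cell i trap , inc i , cong (λ c → just (cell i c)) (bump-trap i i)
    incoming (frozen i)    = frozen i , finish , refl
    outgoing : ∀ v → ∃₂ λ a v′ → δ v a ≡ just v′
    outgoing v = finish , proj₁ (finish-step v) , proj₁ (proj₂ (finish-step v))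

  syncWord : List Letter
  syncWord = reset ∷ incs (countingWord m) ++ finish ∷ []

  cell-syncWord : ∀ i c → run (cell i c) syncWord ≡ just sink
  cell-syncWord i c = begin
    run (cell i off) (incs (countingWord m) ++ finish ∷ [])
      ≡⟨ run-++-just (incs (countingWord m)) (finish ∷ []) (cell-run-incs i off (countingWord m)) ⟩
    run (cell i (bumps (countingWord m) i off)) (finish ∷ [])
      ≡⟨ cong (λ c → run (cell i c) (finish ∷ [])) (bumps-countingWord i) ⟩
    just sink ∎
    where open ≡-Reasoning

  syncWord-ends-at-sink : ∀ {v y} → run v syncWord ≡ just y → y ≡ sink
  syncWord-ends-at-sink {cell i c} r = just-injective (trans (sym r) (cell-syncWord i c))
  syncWord-ends-at-sink {sink}     ()
  syncWord-ends-at-sink {pad k}    ()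
  syncWord-ends-at-sink {frozen i} ()

  syncWord-synchronizing : Fin m → Synchronizing graph syncWord
  syncWord-synchronizing i =
    synchronizing {v = cell i off} (cell-syncWord i off) (λ {v} → syncWord-ends-at-sink {v})

  cell-injective : ∀ {i j c c′} → cell i c ≡ cell j c′ → i ≡ j
  cell-injective refl = refl

  frozen-injective : ∀ {i j} → frozen i ≡ frozen j → i ≡ j
  frozen-injective refl = refl

  frozen-finished : ∀ {i j} c → frozen i ≡ finished j c → i ≡ j
  frozen-finished off  refl = refl
  frozen-finished on   ()
  frozen-finished trap refl = refl

  sink-finished : ∀ {i} c → sink ≡ finished i c → c ≡ on
  sink-finished on   _  = refl
  sink-finished off  ()
  sink-finished trap ()

  finished-collide : ∀ {i j} c c′ → i ≢ j → finished i c ≡ finished j c′ → c ≡ on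
  finished-collide on   _  _   _  = refl
  finished-collide off  c′ i≢j eq = ⊥-elim (i≢j (frozen-finished c′ eq))
  finished-collide trap c′ i≢j eq = ⊥-elim (i≢j (frozen-finished c′ eq))

  finish-free-not-collapsing : ∀ {i j} {w : List Letter} → i ≢ j → All (_≢ finish) w → ¬ Collapsing w
  finish-free-not-collapsing {i} {j} i≢j ∉w collapsing with cell-run i off ∉w | cell-run j off ∉w
  ... | _ , runᵢ | _ , runⱼ = i≢j (cell-injective (collapsing runᵢ runⱼ))

  reset-free-not-collapsing : ∀ {i j} {w : List Letter} → i ≢ j → All (_≢ reset) w → ¬ Collapsing w
  reset-free-not-collapsing {i} {j} i≢j ∉w collapsing =
    i≢j (frozen-injective (collapsing (idle-run (idle-frozen i) ∉w) (idle-run (idle-frozen j) ∉w)))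

  reset-after-finish-dies : ∀ v u x y → run v (u ++ finish ∷ x ++ reset ∷ y) ≡ nothing
  reset-after-finish-dies v u x y with run v u in r
  ... | nothing = trans (run-++ v u _) (cong (_>>= λ v′ → run v′ (finish ∷ x ++ reset ∷ y)) r)
  ... | just v′ with finish-step v′
  ...   | y′ , finish-δ , idle =
    trans (run-++-just u _ r) (trans (run-∷ (x ++ reset ∷ y) finish-δ) (idle-dies idle x y))

  run-from-last-reset : ∀ i u₁ js v → All (_≢ finish) u₁ → All (_≢ reset) v →
    run (cell i off) ((u₁ ++ reset ∷ incs js) ++ finish ∷ v) ≡ just (finished i (bumps js i off))
  run-from-last-reset i u₁ js v ∉u₁ ∉v with cell-run i off ∉u₁
  ... | _ , run-u₁ = trans (run-++-just (u₁ ++ reset ∷ incs js) (finish ∷ v) run-counting)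
                           (idle-run (finished-idle i _) ∉v)
    where
    run-counting : run (cell i off) (u₁ ++ reset ∷ incs js) ≡ just (cell i (bumps js i off))
    run-counting = trans (run-++-just u₁ (reset ∷ incs js) run-u₁) (cell-run-incs i off js)

  -- Distinct bits can only meet in the sink, so every bit must have been counted up to on.
  collapsing-counts : ∀ {i j} → i ≢ j → ∀ u₁ js v → All (_≢ finish) u₁ → All (_≢ reset) v →
    Collapsing ((u₁ ++ reset ∷ incs js) ++ finish ∷ v) → suc (length js) ≡ 2 ^ m
  collapsing-counts {i} {j} i≢j u₁ js v ∉u₁ ∉v collapsing = counting-length js all-on
    where
    ends : ∀ b → run (cell b off) ((u₁ ++ reset ∷ incs js) ++ finish ∷ v) ≡ just (finished b (bumps js b off))
    ends b = run-from-last-reset b u₁ js v ∉u₁ ∉v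
    on-at-i : bumps js i off ≡ on
    on-at-i = finished-collide _ _ i≢j (collapsing (ends i) (ends j))
    all-on : ∀ b → bumps js b off ≡ on
    all-on b = sink-finished _ (trans (cong (finished i) (sym on-at-i)) (collapsing (ends i) (ends b)))

  collapsing-length : ∀ {i j} → i ≢ j → ∀ w → (∃₂ λ v y → run v w ≡ just y) → Collapsing w →
                      2 ^ m ≤ length w
  collapsing-length i≢j w defined collapsing with firstSplit _≟ᶠ_ finish w
  ... | absent ∉w = ⊥-elim (finish-free-not-collapsing i≢j ∉w collapsing)
  ... | first u v ∉u with lastSplit _≟ᶠ_ reset v
  ...   | last x y _ with defined
  ...     | v₀ , _ , r with trans (sym (reset-after-finish-dies v₀ u x y)) r
  ...       | ()
  collapsing-length i≢j w defined collapsing | first u v ∉u | absent ∉v with lastSplit _≟ᶠ_ reset u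
  ... | absent ∉u′ = ⊥-elim (reset-free-not-collapsing i≢j (++⁺ ∉u′ ((λ ()) ∷ ∉v)) collapsing)
  ... | last u₁ u₂ ∉u₂ with incs-only ∉u₂ (All.tail (++⁻ʳ u₁ ∉u))
  ...   | js , refl = begin
    2 ^ m                            ≡⟨ sym (collapsing-counts i≢j u₁ js v (++⁻ˡ u₁ ∉u) ∉v collapsing) ⟩
    suc (length js)                  ≡⟨ cong suc (sym (length-map _ js)) ⟩
    length (reset ∷ incs js)         ≤⟨ length-++-≤ʳ (reset ∷ incs js) {u₁} ⟩
    length (u₁ ++ reset ∷ incs js)   ≤⟨ length-++-≤ˡ (u₁ ++ reset ∷ incs js) ⟩
    length ((u₁ ++ reset ∷ incs js) ++ finish ∷ v) ∎
    where open ≤-Reasoning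

  synchronizing-length : 2 ≤ m → ∀ w → Synchronizing graph w → 2 ^ m ≤ length w
  synchronizing-length 2≤m w sync with distinct-elements 2≤m
  ... | _ , _ , i≢j =
    collapsing-length i≢j w (synchronizing⇒defined sync) (synchronizing⇒collapsing sync)

-- For n ≥ 1, n = 1 + 4 · bits n + padding n with padding n < 4.
bits padding : ℕ → ℕ
bits n    = pred n / 4
padding n = pred n % 4

module Family (n : ℕ) = CounterAutomaton (bits n) (padding n)

family-size : ∀ n → 1 ≤ n → nV (Family.graph n) ≡ n
family-size (suc n) _ = cong suc (sym (m≡m%n+[m/n]*n n 4))

two≤bits : ∀ {n} → 9 ≤ n → 2 ≤ bits n
two≤bits (s≤s 8≤n) = /-monoˡ-≤ 4 8≤n

size≤bits*8 : ∀ {n} → 9 ≤ n → n ≤ bits n * 8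
size≤bits*8 {suc n} 9≤n = begin
  suc n                     ≡⟨ cong suc (m≡m%n+[m/n]*n n 4) ⟩
  suc (n % 4) + n / 4 * 4   ≤⟨ +-monoˡ-≤ (n / 4 * 4) (≤-trans (m%n<n n 4) (*-monoˡ-≤ 4 1≤bits)) ⟩
  n / 4 * 4 + n / 4 * 4     ≡⟨ sym (*-distribˡ-+ (n / 4) 4 4) ⟩
  n / 4 * 8                 ∎
  where
  open ≤-Reasoning
  1≤bits : 1 ≤ n / 4
  1≤bits = ≤-trans (s≤s z≤n) (two≤bits 9≤n)

theorem5p2 : Σ (ℕ → LabeledGraph) λ G → Σ ℕ λ k → Σ ℕ λ N →
      (1 ≤ k) ×
      ((n : ℕ) → IsPresentation (G n) × Deterministic (G n)) ×
      ((n : ℕ) → N ≤ n →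
        (nV (G n) ≡ n) ×
        (Σ (Word (G n)) λ w → Synchronizing (G n) w) ×
        ((w : Word (G n)) → Synchronizing (G n) w → 2 ^ n ≤ length w ^ k))
theorem5p2 =
  Family.graph , 8 , 9 , s≤s z≤n ,
  (λ n → Family.isPresentation n , Family.deterministic n) ,
  λ n 9≤n →
    family-size n (≤-trans (s≤s z≤n) 9≤n) ,
    (Family.syncWord n , Family.syncWord-synchronizing n (fromℕ< (≤-trans (s≤s z≤n) (two≤bits 9≤n)))) ,
    λ w sync → exponential-lower-bound {m = bits n} {k = 8} (size≤bits*8 9≤n) (Family.synchronizing-length n (two≤bits 9≤n) w sync)
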